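{- Let $G=(V,E)$ be a directed graph with non-negative edge weights $w$, let $\xi\in(0,1)$, let $d:V\to\mathbb{R}_{\ge 0}$ be an arbitrary estimate vector, and let $V_{\mathrm{input}}\subseteq V$. After running the procedure $\mathrm{Propagate}(V_{\mathrm{input}})$ (defined in the context), which returns the set $V_{\mathrm{touched}}$, every edge $uv=e\in E$ with $u,v\in V_{\mathrm{touched}}$ satisfies $d(v)\leq d(u)+w(e)$ (with respect to the estimates $d$ as they are after the procedure).
   Context: The procedure $\mathrm{Propagate}(V_{\mathrm{input}})$ modifies the estimates $d$ in place as follows. Initialize a min-priority queue $Q$ containing the vertices of $V_{\mathrm{input}}$, keyed by $d(\cdot)$, and a set $V_{\mathrm{touched}}:=V_{\mathrm{input}}$. While $Q\neq\emptyset$: pop a vertex $u$ with minimum key from $Q$; for every edge $uv=e\in E$: if $v$ is currently in $Q$, set $d(v):=\min(d(v),d(u)+w(e))$ (decreasing its key); otherwise, if $d(v)>(1+\xi)(d(u)+w(e))$, set $d(v):=d(u)+w(e)$ and insert $v$ into $Q$ and into $V_{\mathrm{touched}}$. When $Q$ is empty, return $V_{\mathrm{touched}}$.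
   Formalization: The edge weights $w$, the parameter $\xi$ and the estimates $d$ (before and after the procedure) take rational values instead of real ones. -}

module Defs where

open import Data.Nat using (ℕ)
open import Data.Fin using (Fin; _≟_)
open import Data.Fin.Subset using (Subset; _∈_; _∉_; _∪_; ⁅_⁆; outside)
open import Data.Vec using (_[_]≔_)
open import Data.Rational using (ℚ; _+_; _*_; _≤_; _<_; _⊓_; 1ℚ)
open import Data.Bool using (if_then_else_)
open import Data.Product using (_×_; _,_)
open import Data.List using (List; []; _∷_; filter)
open import Data.List.Relation.Binary.Permutation.Propositional using (_↭_)
open import Relation.Nullary using (does; ¬_)
open import Relation.Binary.Construct.Closure.ReflexiveTransitive using (Star)

-- A directed (multi)graph on vertex set Fin n: a list of weighted edges.
record Edge (n : ℕ) : Set where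
  constructor edge
  field
    src : Fin n
    tgt : Fin n
    wt  : ℚ
open Edge public

update : {n : ℕ} → (Fin n → ℚ) → Fin n → ℚ → (Fin n → ℚ)
update d v x y = if does (y ≟ v) then x else d y

outEdges : {n : ℕ} → List (Edge n) → Fin n → List (Edge n)
outEdges E u = filter (λ e → src e ≟ u) E

-- Configuration of Propagate:
--   current estimates d, the priority queue Q (as a set; keys are d),
--   the set V_touched, and the out-edges of the last popped vertex
--   that still have to be processed.
record Config (n : ℕ) : Set where
  constructor config
  field
    est     : Fin n → ℚ
    queue   : Subset n
    touched : Subset n
    pending : List (Edge n)
open Config public

-- One atomic step of Propagate (nondeterministic: ties in the queue and
-- the order in which the out-edges of u are scanned are arbitrary).
data Step {n : ℕ} (E : List (Edge n)) (ξ : ℚ) : Config n → Config n → Set where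
  pop : ∀ {d Q T es} (u : Fin n) →
        u ∈ Q →
        (∀ x → x ∈ Q → d u ≤ d x) →
        es ↭ outEdges E u →
        Step E ξ (config d Q T []) (config d (Q [ u ]≔ outside) T es)
  relax-inQ : ∀ {d Q T rest} (u v : Fin n) (w : ℚ) →
        v ∈ Q →
        Step E ξ (config d Q T (edge u v w ∷ rest))
                 (config (update d v (d v ⊓ (d u + w))) Q T rest)
  relax-insert : ∀ {d Q T rest} (u v : Fin n) (w : ℚ) →
        v ∉ Q →
        (1ℚ + ξ) * (d u + w) < d v →
        Step E ξ (config d Q T (edge u v w ∷ rest))
                 (config (update d v (d u + w)) (Q ∪ ⁅ v ⁆) (T ∪ ⁅ v ⁆) rest)
  relax-skip : ∀ {d Q T rest} (u v : Fin n) (w : ℚ) →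
        v ∉ Q →
        ¬ ((1ℚ + ξ) * (d u + w) < d v) →
        Step E ξ (config d Q T (edge u v w ∷ rest)) (config d Q T rest)

Steps : {n : ℕ} → List (Edge n) → ℚ → Config n → Config n → Set
Steps E ξ = Star (Step E ξ)

Propagate : {n : ℕ} → List (Edge n) → ℚ →
            (d₀ : Fin n → ℚ) (Vin : Subset n) →
            (d : Fin n → ℚ) (T : Subset n) → Set
Propagate E ξ d₀ Vin d T =
  Steps E ξ (config d₀ Vin Vin []) (config d Data.Fin.Subset.⊥ T [])

{-# OPTIONS --safe #-}
module Submission where

-- Propagate behaves like Dijkstra's algorithm with a lazy insertion rule.
-- Popped keys never decrease, so the key L of the last popped vertex
-- separates the touched vertices outside the queue (keys ≤ L) from the queue
-- (keys ≥ L ≥ 0), and an estimate only changes while its vertex is in the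
-- queue or when it is inserted. Once u is popped and an out-edge uv scanned,
-- either d(v) ≤ d(u) + w, which stays true as estimates only decrease, or v
-- was left untouched with d(v) ≤ (1+ξ)(d(u) + w). If v is inserted later
-- via u'v', the insertion test (1+ξ)(d(u') + w') < d(v) forces the new value
-- d(u') + w' below d(u) + w. When the queue is empty, every out-edge of a
-- touched vertex has been scanned, so it is relaxed if its target is touched.

open import Defs
open import Data.Nat using (ℕ)
open import Data.Fin using (Fin; zero; suc; _≟_)
open import Data.Fin.Properties using (suc-injective)
open import Data.Fin.Subset using (Subset; _∈_; _∉_; _∪_; ⁅_⁆; ⊥; outside)
open import Data.Fin.Subset.Properties using (x∈p∪q⁻; x∈p∪q⁺; x∈⁅x⁆; x∈⁅y⁆⇒x≡y; ∉⊥; _∈?_)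
open import Data.Vec using (_∷_; _[_]≔_; here; there)
open import Data.Vec.Properties using ([]≔-minimal)
open import Data.List using (List; []; _∷_)
open import Data.List.Membership.Propositional using () renaming (_∈_ to _∈ₗ_)
open import Data.List.Membership.Propositional.Properties using (∈-filter⁺; ∈-filter⁻)
open import Data.List.Relation.Unary.Any using (here; there)
open import Data.List.Relation.Binary.Permutation.Propositional using (_↭_; ↭-sym)
open import Data.List.Relation.Binary.Permutation.Propositional.Properties using (∈-resp-↭)
open import Data.Rational using (ℚ; _+_; _*_; _≤_; _<_; _⊓_; 0ℚ; 1ℚ; nonNegative)
open import Data.Rational.Properties
  using (nonNegative⁻¹; ≤-refl; ≤-reflexive; ≤-trans; ≤-<-trans; <⇒≤; ≮⇒≥;
         +-identityʳ; *-identityˡ; +-monoʳ-≤; *-monoʳ-≤-nonNeg; *-cancelˡ-<-nonNeg; ⊓-glb; p⊓q≤p; p⊓q≤q; module ≤-Reasoning)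
open import Data.Product using (∃; _×_; _,_; proj₁; proj₂)
import Data.Product as Product
open import Data.Sum using (_⊎_; inj₁; inj₂)
import Data.Sum as Sum
open import Function using (_∘_)
open import Relation.Nullary using (¬_; Dec; yes; no; contradiction)
open import Relation.Binary.PropositionalEquality using (_≡_; _≢_; refl; sym; cong; subst)
open import Relation.Binary.Construct.Closure.ReflexiveTransitive using (ε; _◅_)

private
  variable
    n : ℕ

∈-[]≔outside⁻ : (p : Subset n) {x y : Fin n} → x ∈ p [ y ]≔ outside → x ≢ y × x ∈ p
∈-[]≔outside⁻ (_ ∷ p) {zero}  {zero}  ()
∈-[]≔outside⁻ (_ ∷ p) {zero}  {suc y} here       = (λ ()) , here
∈-[]≔outside⁻ (_ ∷ p) {suc x} {zero}  (there x∈) = (λ ()) , there x∈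
∈-[]≔outside⁻ (_ ∷ p) {suc x} {suc y} (there x∈) =
  Product.map (_∘ suc-injective) there (∈-[]≔outside⁻ p x∈)

∈-∪⁅⁆⁻ : (p : Subset n) {x y : Fin n} → x ∈ p ∪ ⁅ y ⁆ → x ∈ p ⊎ x ≡ y
∈-∪⁅⁆⁻ p = Sum.map₂ (x∈⁅y⁆⇒x≡y _) ∘ x∈p∪q⁻ p _

∈-∪⁅⁆-≢⁻ : (p : Subset n) {x y : Fin n} → x ∈ p ∪ ⁅ y ⁆ → x ≢ y → x ∈ p
∈-∪⁅⁆-≢⁻ p x∈ x≢y = Sum.[ (λ x∈p → x∈p) , (λ x≡y → contradiction x≡y x≢y) ] (∈-∪⁅⁆⁻ p x∈)

∉-∪⁅⁆⁻ : {p : Subset n} {x y : Fin n} → x ∉ p ∪ ⁅ y ⁆ → x ≢ y × x ∉ p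
∉-∪⁅⁆⁻ x∉ = (λ { refl → x∉ (x∈p∪q⁺ (inj₂ (x∈⁅x⁆ _))) }) , x∉ ∘ x∈p∪q⁺ ∘ inj₁

update-≡ : (d : Fin n → ℚ) (v : Fin n) (a : ℚ) → update d v a v ≡ a
update-≡ d v a with v ≟ v
... | yes _  = refl
... | no v≢v = contradiction refl v≢v

update-≢ : (d : Fin n → ℚ) {v y : Fin n} (a : ℚ) → y ≢ v → update d v a y ≡ d y
update-≢ d {v} {y} a y≢v with y ≟ v
... | yes y≡v = contradiction y≡v y≢v
... | no _    = refl

update-≤ : (d : Fin n → ℚ) {v : Fin n} {a : ℚ} → a ≤ d v → ∀ y → update d v a y ≤ d y
update-≤ d {v} a≤dv y with y ≟ v
... | yes refl = a≤dv
... | no _     = ≤-refl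

update-≥ : (d : Fin n → ℚ) {v y : Fin n} {a b : ℚ} → b ≤ a → b ≤ d y → b ≤ update d v a y
update-≥ d {v} {y} b≤a b≤dy with y ≟ v
... | yes _ = b≤a
... | no _  = b≤dy

p≤p+q : ∀ p {q} → 0ℚ ≤ q → p ≤ p + q
p≤p+q p {q} 0≤q = begin
  p       ≡⟨ sym (+-identityʳ p) ⟩
  p + 0ℚ  ≤⟨ +-monoʳ-≤ p 0≤q ⟩
  p + q   ∎
  where open ≤-Reasoning

p≤[1+r]*p : ∀ {r} p → 0ℚ ≤ r → 0ℚ ≤ p → p ≤ (1ℚ + r) * p
p≤[1+r]*p {r} p 0≤r 0≤p = begin
  p             ≡⟨ sym (*-identityˡ p) ⟩
  1ℚ * p        ≤⟨ *-monoʳ-≤-nonNeg p {{nonNegative 0≤p}} (p≤p+q 1ℚ 0≤r) ⟩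
  (1ℚ + r) * p  ∎
  where open ≤-Reasoning

[1+r]*p<s≤[1+r]*q⇒p≤q : ∀ {r p q s} → 0ℚ ≤ r → (1ℚ + r) * p < s → s ≤ (1ℚ + r) * q → p ≤ q
[1+r]*p<s≤[1+r]*q⇒p≤q {r} 0≤r rp<s s≤rq =
  <⇒≤ (*-cancelˡ-<-nonNeg (1ℚ + r) {{nonNegative 0≤1+r}} (begin-strict
    (1ℚ + r) * _  <⟨ rp<s ⟩
    _             ≤⟨ s≤rq ⟩
    (1ℚ + r) * _  ∎))
  where
  open ≤-Reasoning
  0≤1+r : 0ℚ ≤ 1ℚ + r
  0≤1+r = ≤-trans (nonNegative⁻¹ 1ℚ) (p≤p+q 1ℚ 0≤r)

Relaxed : (Fin n → ℚ) → Edge n → Set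
Relaxed d e = d (tgt e) ≤ d (src e) + wt e

relaxed-update : (d : Fin n → ℚ) {u v : Fin n} {w a : ℚ} →
                 u ≢ v → a ≤ d u + w → Relaxed (update d v a) (edge u v w)
relaxed-update d {u} {v} {w} {a} u≢v a≤du+w = begin
  update d v a v      ≡⟨ update-≡ d v a ⟩
  a                   ≤⟨ a≤du+w ⟩
  d u + w             ≡⟨ cong (_+ w) (sym (update-≢ d a u≢v)) ⟩
  update d v a u + w  ∎
  where open ≤-Reasoning

update-preserves-bound : (d : Fin n → ℚ) {v : Fin n} {a : ℚ} → a ≤ d v →
                         {e : Edge n} → src e ≢ v → (f : ℚ → ℚ) →
                         d (tgt e) ≤ f (d (src e)) →
                         update d v a (tgt e) ≤ f (update d v a (src e))
update-preserves-bound d {a = a} a≤dv {e} src≢v f bound =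
  ≤-trans (update-≤ d a≤dv (tgt e))
          (subst (λ s → d (tgt e) ≤ f s) (sym (update-≢ d a src≢v)) bound)

module Propagation {n : ℕ} (E : List (Edge n)) (ξ : ℚ)
                   (0≤w : ∀ e → e ∈ₗ E → 0ℚ ≤ wt e) (0≤ξ : 0ℚ ≤ ξ) where

  Skipped : (Fin n → ℚ) → Subset n → Edge n → Set
  Skipped d T e = tgt e ∉ T × d (tgt e) ≤ (1ℚ + ξ) * (d (src e) + wt e)

  Scanned : (Fin n → ℚ) → Subset n → Edge n → Set
  Scanned d T e = Relaxed d e ⊎ Skipped d T e

  scanned-update : (d : Fin n → ℚ) {T : Subset n} {v : Fin n} {a : ℚ} → a ≤ d v →
                   {e : Edge n} → src e ≢ v → Scanned d T e → Scanned (update d v a) T e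
  scanned-update d a≤dv {e} src≢v = Sum.map
    (update-preserves-bound d a≤dv {e} src≢v (_+ wt e))
    (Product.map₂ (update-preserves-bound d a≤dv {e} src≢v (λ s → (1ℚ + ξ) * (s + wt e))))

  insertion-lowers : ∀ {a b} → 0ℚ ≤ a → (1ℚ + ξ) * a < b → a ≤ b
  insertion-lowers {a} 0≤a ξa<b = <⇒≤ (≤-<-trans (p≤[1+r]*p a 0≤ξ 0≤a) ξa<b)

  inserted-target-relaxed : (d : Fin n → ℚ) {v : Fin n} {a : ℚ} → (1ℚ + ξ) * a < d v →
                            {e : Edge n} → tgt e ≡ v → src e ≢ v →
                            d (tgt e) ≤ (1ℚ + ξ) * (d (src e) + wt e) →
                            Relaxed (update d v a) e
  inserted-target-relaxed d ξa<dv refl src≢v slack =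
    relaxed-update d src≢v ([1+r]*p<s≤[1+r]*q⇒p≤q 0≤ξ ξa<dv slack)

  scanned-insert : (d : Fin n → ℚ) {T : Subset n} {v : Fin n} {a : ℚ} →
                   0ℚ ≤ a → (1ℚ + ξ) * a < d v →
                   {e : Edge n} → src e ≢ v → Scanned d T e →
                   Scanned (update d v a) (T ∪ ⁅ v ⁆) e
  scanned-insert d 0≤a ξa<dv {e} src≢v (inj₁ relaxed) =
    inj₁ (update-preserves-bound d (insertion-lowers 0≤a ξa<dv) {e} src≢v (_+ wt e) relaxed)
  scanned-insert d {T} {v} {a} 0≤a ξa<dv {e} src≢v (inj₂ (tgt∉T , slack)) = by-target (tgt e ≟ v)
    where
    by-target : Dec (tgt e ≡ v) → Scanned (update d v a) (T ∪ ⁅ v ⁆) e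
    by-target (yes tgt≡v) = inj₁ (inserted-target-relaxed d ξa<dv tgt≡v src≢v slack)
    by-target (no tgt≢v)  =
      inj₂ ( (λ tgt∈ → Sum.[ tgt∉T , tgt≢v ] (∈-∪⁅⁆⁻ T tgt∈))
           , update-preserves-bound d (insertion-lowers 0≤a ξa<dv) {e} src≢v
               (λ s → (1ℚ + ξ) * (s + wt e)) slack )

  -- L is the key of the most recently popped vertex (0 before the first pop).
  record Invariant (L : ℚ) (c : Config n) : Set where
    field
      0≤L           : 0ℚ ≤ L
      pending⊆E     : ∀ {e} → e ∈ₗ pending c → e ∈ₗ E
      queue⊆touched : ∀ {x} → x ∈ queue c → x ∈ touched c
      queue-above   : ∀ {x} → x ∈ queue c → L ≤ est c x
      pending-above : ∀ {e} → e ∈ₗ pending c → L ≤ est c (src e)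
      settled-below : ∀ {x} → x ∈ touched c → x ∉ queue c → est c x ≤ L
      scanned       : ∀ {e} → e ∈ₗ E → src e ∈ touched c → src e ∉ queue c →
                      e ∈ₗ pending c ⊎ Scanned (est c) (touched c) e
  open Invariant

  initial : (d₀ : Fin n → ℚ) → (∀ x → 0ℚ ≤ d₀ x) → (Vin : Subset n) →
            Invariant 0ℚ (config d₀ Vin Vin [])
  initial d₀ 0≤d₀ Vin = record
    { 0≤L           = ≤-refl
    ; pending⊆E     = λ ()
    ; queue⊆touched = λ x∈ → x∈
    ; queue-above   = λ {x} _ → 0≤d₀ x
    ; pending-above = λ ()
    ; settled-below = λ x∈ x∉ → contradiction x∈ x∉
    ; scanned       = λ _ src∈ src∉ → contradiction src∈ src∉
    }

  pop-preserves : ∀ {L d Q T es} (u : Fin n) → u ∈ Q → (∀ x → x ∈ Q → d u ≤ d x) →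
                  es ↭ outEdges E u →
                  Invariant L (config d Q T []) →
                  Invariant (d u) (config d (Q [ u ]≔ outside) T es)
  pop-preserves {d = d} {Q = Q} {T = T} {es = es} u u∈Q u-min es↭ I = record
    { 0≤L           = ≤-trans (0≤L I) (queue-above I u∈Q)
    ; pending⊆E     = proj₁ ∘ out-edge
    ; queue⊆touched = queue⊆touched I ∘ proj₂ ∘ ∈-[]≔outside⁻ Q
    ; queue-above   = λ x∈ → u-min _ (proj₂ (∈-[]≔outside⁻ Q x∈))
    ; pending-above = λ e∈ → ≤-reflexive (cong d (sym (proj₂ (out-edge e∈))))
    ; settled-below = settled-below′
    ; scanned       = scanned′
    }
    where
    out-edge : ∀ {e} → e ∈ₗ es → e ∈ₗ E × src e ≡ u
    out-edge = ∈-filter⁻ (λ e → src e ≟ u) {xs = E} ∘ ∈-resp-↭ es↭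

    still-out : ∀ {x} → x ∉ Q [ u ]≔ outside → x ≢ u → x ∉ Q
    still-out x∉ x≢u x∈Q = x∉ ([]≔-minimal Q _ u x≢u x∈Q)

    settled-below′ : ∀ {x} → x ∈ T → x ∉ Q [ u ]≔ outside → d x ≤ d u
    settled-below′ {x} x∈T x∉ with x ≟ u
    ... | yes refl = ≤-refl
    ... | no x≢u   = ≤-trans (settled-below I x∈T (still-out x∉ x≢u)) (queue-above I u∈Q)

    scanned′ : ∀ {e} → e ∈ₗ E → src e ∈ T → src e ∉ Q [ u ]≔ outside →
               e ∈ₗ es ⊎ Scanned d T e
    scanned′ {e} e∈E src∈T src∉ with src e ≟ u
    ... | yes src≡u = inj₁ (∈-resp-↭ (↭-sym es↭) (∈-filter⁺ (λ e → src e ≟ u) e∈E src≡u))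
    ... | no src≢u  = Sum.map₁ (λ ()) (scanned I e∈E src∈T (still-out src∉ src≢u))

  pending-head-above : ∀ {L d Q T u v w rest} →
                       Invariant L (config d Q T (edge u v w ∷ rest)) → L ≤ d u + w
  pending-head-above {d = d} {u = u} I =
    ≤-trans (pending-above I (here refl)) (p≤p+q (d u) (0≤w _ (pending⊆E I (here refl))))

  relax-inQ-preserves : ∀ {L d Q T rest} (u v : Fin n) (w : ℚ) → v ∈ Q →
                        Invariant L (config d Q T (edge u v w ∷ rest)) →
                        Invariant L (config (update d v (d v ⊓ (d u + w))) Q T rest)
  relax-inQ-preserves {L} {d} {Q} {T} {rest} u v w v∈Q I = record
    { 0≤L           = 0≤L I
    ; pending⊆E     = pending⊆E I ∘ there
    ; queue⊆touched = queue⊆touched I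
    ; queue-above   = λ x∈ → update-≥ d L≤a (queue-above I x∈)
    ; pending-above = λ e∈ → update-≥ d L≤a (pending-above I (there e∈))
    ; settled-below = λ x∈ x∉ → ≤-trans (update-≤ d a≤dv _) (settled-below I x∈ x∉)
    ; scanned       = scanned′
    }
    where
    a : ℚ
    a = d v ⊓ (d u + w)

    a≤dv : a ≤ d v
    a≤dv = p⊓q≤p (d v) (d u + w)

    L≤a : L ≤ a
    L≤a = ⊓-glb (queue-above I v∈Q) (pending-head-above I)

    ≢v : ∀ {x} → x ∉ Q → x ≢ v
    ≢v x∉Q refl = x∉Q v∈Q

    scanned′ : ∀ {e} → e ∈ₗ E → src e ∈ T → src e ∉ Q →
               e ∈ₗ rest ⊎ Scanned (update d v a) T e
    scanned′ e∈E src∈T src∉Q with scanned I e∈E src∈T src∉Q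
    ... | inj₁ (here refl) = inj₂ (inj₁ (relaxed-update d (≢v src∉Q) (p⊓q≤q (d v) (d u + w))))
    ... | inj₁ (there e∈)  = inj₁ e∈
    ... | inj₂ s           = inj₂ (scanned-update d a≤dv (≢v src∉Q) s)

  relax-insert-preserves : ∀ {L d Q T rest} (u v : Fin n) (w : ℚ) → v ∉ Q →
                           (1ℚ + ξ) * (d u + w) < d v →
                           Invariant L (config d Q T (edge u v w ∷ rest)) →
                           Invariant L (config (update d v (d u + w))
                                               (Q ∪ ⁅ v ⁆) (T ∪ ⁅ v ⁆) rest)
  relax-insert-preserves {L} {d} {Q} {T} {rest} u v w v∉Q ξa<dv I = record
    { 0≤L           = 0≤L I
    ; pending⊆E     = pending⊆E I ∘ there
    ; queue⊆touched = Sum.[ x∈p∪q⁺ ∘ inj₁ ∘ queue⊆touched I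
                          , (λ { refl → x∈p∪q⁺ (inj₂ (x∈⁅x⁆ v)) }) ]
                      ∘ ∈-∪⁅⁆⁻ Q
    ; queue-above   = Sum.[ update-≥ d L≤a ∘ queue-above I
                          , (λ { refl → subst (L ≤_) (sym (update-≡ d v a)) L≤a }) ]
                      ∘ ∈-∪⁅⁆⁻ Q
    ; pending-above = λ e∈ → update-≥ d L≤a (pending-above I (there e∈))
    ; settled-below = settled-below′
    ; scanned       = scanned′
    }
    where
    a : ℚ
    a = d u + w

    L≤a : L ≤ a
    L≤a = pending-head-above I

    0≤a : 0ℚ ≤ a
    0≤a = ≤-trans (0≤L I) L≤a

    settled-below′ : ∀ {x} → x ∈ T ∪ ⁅ v ⁆ → x ∉ Q ∪ ⁅ v ⁆ → update d v a x ≤ L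
    settled-below′ x∈ x∉ with ∉-∪⁅⁆⁻ x∉
    ... | x≢v , x∉Q = ≤-trans (update-≤ d (insertion-lowers 0≤a ξa<dv) _)
                              (settled-below I (∈-∪⁅⁆-≢⁻ T x∈ x≢v) x∉Q)

    scanned′ : ∀ {e} → e ∈ₗ E → src e ∈ T ∪ ⁅ v ⁆ → src e ∉ Q ∪ ⁅ v ⁆ →
               e ∈ₗ rest ⊎ Scanned (update d v a) (T ∪ ⁅ v ⁆) e
    scanned′ e∈E src∈ src∉ with ∉-∪⁅⁆⁻ src∉
    ... | src≢v , src∉Q with scanned I e∈E (∈-∪⁅⁆-≢⁻ T src∈ src≢v) src∉Q
    ...   | inj₁ (here refl) = inj₂ (inj₁ (relaxed-update d src≢v ≤-refl))
    ...   | inj₁ (there e∈)  = inj₁ e∈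
    ...   | inj₂ s           = inj₂ (scanned-insert d 0≤a ξa<dv src≢v s)

  relax-skip-preserves : ∀ {L d Q T rest} (u v : Fin n) (w : ℚ) → v ∉ Q →
                         ¬ ((1ℚ + ξ) * (d u + w) < d v) →
                         Invariant L (config d Q T (edge u v w ∷ rest)) →
                         Invariant L (config d Q T rest)
  relax-skip-preserves {L} {d} {Q} {T} {rest} u v w v∉Q ξa≮dv I = record
    { 0≤L           = 0≤L I
    ; pending⊆E     = pending⊆E I ∘ there
    ; queue⊆touched = queue⊆touched I
    ; queue-above   = queue-above I
    ; pending-above = pending-above I ∘ there
    ; settled-below = settled-below I
    ; scanned       = scanned′
    }
    where
    scanned′ : ∀ {e} → e ∈ₗ E → src e ∈ T → src e ∉ Q → e ∈ₗ rest ⊎ Scanned d T e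
    scanned′ e∈E src∈T src∉Q with scanned I e∈E src∈T src∉Q
    ... | inj₁ (there e∈)  = inj₁ e∈
    ... | inj₂ s           = inj₂ s
    ... | inj₁ (here refl) with v ∈? T
    ...   | yes v∈T = inj₂ (inj₁ (≤-trans (settled-below I v∈T v∉Q) (pending-head-above I)))
    ...   | no v∉T  = inj₂ (inj₂ (v∉T , ≮⇒≥ ξa≮dv))

  step-preserves : ∀ {L c c′} → Step E ξ c c′ → Invariant L c → ∃ λ L′ → Invariant L′ c′
  step-preserves (pop u u∈Q u-min es↭)         I = _ , pop-preserves u u∈Q u-min es↭ I
  step-preserves (relax-inQ u v w v∈Q)          I = _ , relax-inQ-preserves u v w v∈Q I
  step-preserves (relax-insert u v w v∉Q ξa<dv) I = _ , relax-insert-preserves u v w v∉Q ξa<dv I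
  step-preserves (relax-skip u v w v∉Q ξa≮dv)   I = _ , relax-skip-preserves u v w v∉Q ξa≮dv I

  steps-preserve : ∀ {L c c′} → Steps E ξ c c′ → Invariant L c → ∃ λ L′ → Invariant L′ c′
  steps-preserve ε        I = _ , I
  steps-preserve (s ◅ ss) I = steps-preserve ss (proj₂ (step-preserves s I))

  terminal-relaxed : ∀ {L d T e} → Invariant L (config d ⊥ T []) →
                     e ∈ₗ E → src e ∈ T → tgt e ∈ T → Relaxed d e
  terminal-relaxed I e∈E src∈T tgt∈T with scanned I e∈E src∈T ∉⊥
  ... | inj₁ ()
  ... | inj₂ (inj₁ relaxed)     = relaxed
  ... | inj₂ (inj₂ (tgt∉T , _)) = contradiction tgt∈T tgt∉T

lemma1 : (n : ℕ) (E : List (Edge n)) (ξ : ℚ) →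
         (∀ e → e ∈ₗ E → 0ℚ ≤ wt e) →
         0ℚ < ξ → ξ < 1ℚ →
         (d₀ : Fin n → ℚ) → (∀ x → 0ℚ ≤ d₀ x) →
         (Vin : Subset n) (d : Fin n → ℚ) (T : Subset n) →
         Propagate E ξ d₀ Vin d T →
         ∀ e → e ∈ₗ E → src e ∈ T → tgt e ∈ T →
         d (tgt e) ≤ d (src e) + wt e
lemma1 n E ξ 0≤w 0<ξ _ d₀ 0≤d₀ Vin d T run e =
  terminal-relaxed (proj₂ (steps-preserve run (initial d₀ 0≤d₀ Vin)))
  where open Propagation E ξ 0≤w (<⇒≤ 0<ξ)
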